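{- Let $S \subset \mathbb{N}$ and, for each $s \in S$, let $Q_s(t) \in \mathbb{Q}[t]$ be a polynomial with $Q_s(0)=0$ and $Q_s(1)\neq 0$; put $Q=\{Q_s\}_{s\in S}$. Suppose that for all $r,s \in S$ there exist rational numbers $\lambda_j(r,s)$ (for $j\in S$, $1\le j\le r+s$) such that \[ Q_r(t)\, Q_s(t) = \sum_{\substack{j\in S\\ 1\le j\le r+s}} \lambda_j(r,s)\,(1-t)^{r+s-j}\, Q_j(t). \] Then the $\mathbb{Q}$-vector space $Z(Q,S)$ is a $\mathbb{Q}$-algebra, i.e. it is closed under multiplication in $\mathbb{Q}[[q]]$.
   Context: For $s_1,\dots,s_l\in S$ define the formal power series \[ Z_Q(s_1,\dots,s_l) := \sum_{n_1>n_2>\dots>n_l>0} \prod_{j=1}^l \frac{Q_{s_j}(q^{n_j})}{(1-q^{n_j})^{s_j}} \in \mathbb{Q}[[q]], \] and set $Z_Q(\emptyset)=1$. Let $Z(Q,S)$ be the $\mathbb{Q}$-vector space spanned by all $Z_Q(s_1,\dots,s_l)$ with $l\ge 0$ and $s_1,\dots,s_l\in S$ (so $\mathbb{Q}\subset Z(Q,S)$). -}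

module Defs where

open import Data.Nat using (ℕ; zero; suc; _∸_)
open import Data.Nat.DivMod using (_/_; _%_)
open import Data.Rational using (ℚ; 0ℚ; 1ℚ; _+_; _*_; -_)
open import Data.List using (List; []; _∷_)
open import Data.List.Relation.Unary.All using (All)
open import Data.Product using (_×_; _,_; ∃)
open import Relation.Binary.PropositionalEquality using (_≡_)
open import Relation.Nullary using (yes; no)

-- Formal power series over ℚ, as coefficient functions (coefficient of q^n).
Series : Set
Series = ℕ → ℚ

sumTo : (ℕ → ℚ) → ℕ → ℚ
sumTo h zero    = 0ℚ
sumTo h (suc n) = sumTo h n + h n

_⊕_ : Series → Series → Series
(f ⊕ g) n = f n + g n

scale : ℚ → Series → Series
scale c f n = c * f n

_⊛_ : Series → Series → Series
(f ⊛ g) n = sumTo (λ i → f i * g (n ∸ i)) (suc n)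

zeroS : Series
zeroS _ = 0ℚ

oneS : Series
oneS zero    = 1ℚ
oneS (suc _) = 0ℚ

oneMinusT : Series
oneMinusT zero          = 1ℚ
oneMinusT (suc zero)    = - 1ℚ
oneMinusT (suc (suc _)) = 0ℚ

geom : Series
geom _ = 1ℚ

powS : Series → ℕ → Series
powS f zero    = oneS
powS f (suc k) = f ⊛ powS f k

-- Polynomials in ℚ[t] as coefficient lists (index i = coefficient of t^i)
Poly : Set
Poly = List ℚ

coeff : Poly → ℕ → ℚ
coeff []       _       = 0ℚ
coeff (a ∷ p)  zero    = a
coeff (a ∷ p)  (suc i) = coeff p i

poly : Poly → Series
poly = coeff

evalAt1 : Poly → ℚ
evalAt1 []      = 0ℚ
evalAt1 (a ∷ p) = a + evalAt1 p

-- substitution t ↦ q^(suc k) into a series g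
substPow : Series → ℕ → Series
substPow g k m with m % suc k Data.Nat.≟ 0
... | yes _ = g (m / suc k)
... | no  _ = 0ℚ

-- the series Q_s(q^n) / (1 - q^n)^s, with n = suc k
term : (ℕ → Poly) → ℕ → ℕ → Series
term Q s k = substPow (poly (Q s) ⊛ powS geom s) k

sumSer : (ℕ → Series) → ℕ → Series
sumSer F B n = sumTo (λ k → F k n) B

-- T Q ss B = Σ_{B > k_1 > ... > k_l ≥ 0} Π_j term Q s_j k_j
-- (i.e. the sum over B ≥ n_1 > ... > n_l > 0 with n_j = k_j + 1)
T : (ℕ → Poly) → List ℕ → ℕ → Series
T Q []       B = oneS
T Q (s ∷ ss) B = sumSer (λ k → term Q s k ⊛ T Q ss k) B

-- Z_Q(s_1,...,s_l): the coefficient of q^N only receives contributions from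
-- terms with n_1 ≤ N (as Q_s(0) = 0), so it is the q^N coefficient of the
-- truncated sum with n_1 ≤ N + 1.
ZQ : (ℕ → Poly) → List ℕ → Series
ZQ Q ss N = T Q ss (suc N) N

linComb : List (ℚ × Series) → Series
linComb []            = zeroS
linComb ((c , f) ∷ l) = scale c f ⊕ linComb l

mapZ : (ℕ → Poly) → List (ℚ × List ℕ) → List (ℚ × Series)
mapZ Q []             = []
mapZ Q ((c , w) ∷ l)  = (c , ZQ Q w) ∷ mapZ Q l

-- membership in Z(Q,S) = span_ℚ { Z_Q(w) : w a word over S }
InZ : (ℕ → Poly) → (ℕ → Set) → Series → Set
InZ Q S f = ∃ λ (cs : List (ℚ × List ℕ)) →
  All (λ p → All S (Data.Product.proj₂ p)) cs × (∀ n → f n ≡ linComb (mapZ Q cs) n)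

module Submission where

-- Put t s k = Q_s(q^(k+1)) / (1 - q^(k+1))^s, so that Z_Q(s₁,…,s_l) is the
-- iterated sum Σ_{k₁ > ⋯ > k_l ≥ 0} t s₁ k₁ ⋯ t s_l k_l.  Dividing the
-- hypothesis on Q_r Q_s by (1 - t)^(r+s) and substituting t ↦ q^(k+1) shows
-- that letters multiply at equal index:  t r k · t s k = Σ_j λ_j(r,s) t j k.
-- For any letters with such a rule, a product of two iterated sums with upper
-- bound B is a ℚ-linear combination of iterated sums (the quasi-shuffle
-- formula), by induction on B, splitting off the largest index.  As Q_s(0) = 0,
-- the q^N coefficient only sees indices k ≤ N, so B = N + 1 gives the theorem.

open import Defs
open import Data.Nat using (ℕ; zero; suc; _+_; _∸_; _*_; _≤_; _<_; s≤s; _≟_)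
open import Data.Nat.Properties
  using (≤-refl; ≤-trans; ≤-pred; n≤1+n; m≤n⇒m≤1+n; m≤m+n; m∸n≤m; +-comm; +-suc;
         <-irrefl; m+[n∸m]≡n; m∸n+n≡m; m+n∸m≡n; m+n∸n≡m; m∸[m∸n]≡n;
         ∸-+-assoc; +-∸-assoc; *-distribʳ-∸)
open import Data.Nat.Divisibility
  using (_∣_; _∣?_; m%n≡0⇒n∣m; n∣m⇒m%n≡0; ∣⇒≤; n∣m*n; ∣m+n∣m⇒∣n; ∣m∸n∣n⇒∣m)
open import Data.Nat.DivMod using (_/_; _%_; m<n⇒m/n≡0; m*n/n≡m; m/n*n≡m)
open import Data.Rational using (ℚ; 0ℚ; 1ℚ; -_) renaming (_+_ to _⊹_; _*_ to _·_)
import Data.Rational.Properties as ℚ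
open import Data.Rational.Solver using (module +-*-Solver)
open +-*-Solver using (solve; _:+_; _:*_; _:=_)
open import Data.List using (List; []; _∷_; map; _++_)
open import Data.List.Relation.Unary.All using (All; []; _∷_)
import Data.List.Relation.Unary.All as All
open import Data.Product using (_×_; _,_; ∃; Σ; proj₁; proj₂; map₂)
open import Function using (_∘_)
open import Relation.Binary.PropositionalEquality
import Relation.Binary.Reasoning.Setoid as SetoidReasoning
open import Relation.Binary.Bundles using (Setoid)
open import Relation.Nullary using (¬_; yes; no)
open import Data.Empty using (⊥-elim)

sumTo-cong : ∀ {h h′} n → (∀ i → i < n → h i ≡ h′ i) → sumTo h n ≡ sumTo h′ n
sumTo-cong zero    e = refl
sumTo-cong (suc n) e = cong₂ _⊹_ (sumTo-cong n (λ i i<n → e i (m≤n⇒m≤1+n i<n))) (e n ≤-refl)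

sumTo-zero : ∀ {h} n → (∀ i → i < n → h i ≡ 0ℚ) → sumTo h n ≡ 0ℚ
sumTo-zero zero    e = refl
sumTo-zero (suc n) e = cong₂ _⊹_ (sumTo-zero n (λ i i<n → e i (m≤n⇒m≤1+n i<n))) (e n ≤-refl)

sumTo-+ : ∀ h h′ n → sumTo (λ i → h i ⊹ h′ i) n ≡ sumTo h n ⊹ sumTo h′ n
sumTo-+ h h′ zero    = refl
sumTo-+ h h′ (suc n) = trans (cong (_⊹ (h n ⊹ h′ n)) (sumTo-+ h h′ n))
  (solve 4 (λ a b c d → (a :+ b) :+ (c :+ d) := (a :+ c) :+ (b :+ d)) refl
     (sumTo h n) (sumTo h′ n) (h n) (h′ n))

sumTo-scaleˡ : ∀ c h n → sumTo (λ i → c · h i) n ≡ c · sumTo h n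
sumTo-scaleˡ c h zero    = sym (ℚ.*-zeroʳ c)
sumTo-scaleˡ c h (suc n) =
  trans (cong (_⊹ (c · h n)) (sumTo-scaleˡ c h n)) (sym (ℚ.*-distribˡ-+ c (sumTo h n) (h n)))

sumTo-scaleʳ : ∀ c h n → sumTo (λ i → h i · c) n ≡ sumTo h n · c
sumTo-scaleʳ c h n =
  trans (sumTo-cong n (λ i _ → ℚ.*-comm (h i) c)) (trans (sumTo-scaleˡ c h n) (ℚ.*-comm c _))

sumTo-front : ∀ h n → sumTo h (suc n) ≡ h 0 ⊹ sumTo (h ∘ suc) n
sumTo-front h zero    = trans (ℚ.+-identityˡ (h 0)) (sym (ℚ.+-identityʳ (h 0)))
sumTo-front h (suc n) = trans (cong (_⊹ h (suc n)) (sumTo-front h n)) (ℚ.+-assoc (h 0) _ _)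

sumTo-split : ∀ h m n → sumTo h (m + n) ≡ sumTo h m ⊹ sumTo (λ i → h (m + i)) n
sumTo-split h m zero    = trans (cong (sumTo h) (+-comm m 0)) (sym (ℚ.+-identityʳ _))
sumTo-split h m (suc n) = trans (cong (sumTo h) (+-suc m n))
  (trans (cong (_⊹ h (m + n)) (sumTo-split h m n))
         (ℚ.+-assoc (sumTo h m) (sumTo (λ i → h (m + i)) n) (h (m + n))))

sumTo-reverse : ∀ h n → sumTo h (suc n) ≡ sumTo (λ i → h (n ∸ i)) (suc n)
sumTo-reverse h zero    = refl
sumTo-reverse h (suc n) = trans (cong (_⊹ h (suc n)) (sumTo-reverse h n))
  (trans (ℚ.+-comm (sumTo (λ i → h (n ∸ i)) (suc n)) (h (suc n)))
         (sym (sumTo-front (λ i → h (suc n ∸ i)) (suc n))))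

sumTo-triangle : ∀ (F : ℕ → ℕ → ℚ) N →
  sumTo (λ m → sumTo (λ i → F i m) (suc m)) N ≡ sumTo (λ i → sumTo (λ j → F i (i + j)) (N ∸ i)) N
sumTo-triangle F zero    = refl
sumTo-triangle F (suc N) = begin
    rows N ⊹ (sumTo (λ i → F i N) N ⊹ F N N)
      ≡⟨ cong (_⊹ (sumTo (λ i → F i N) N ⊹ F N N)) (sumTo-triangle F N) ⟩
    cols N ⊹ (sumTo (λ i → F i N) N ⊹ F N N)
      ≡⟨ cong (λ x → cols N ⊹ (x ⊹ F N N))
              (sumTo-cong N (λ i i<N → cong (F i) (sym (m+[n∸m]≡n (≤-trans (n≤1+n i) i<N))))) ⟩
    cols N ⊹ (sumTo (λ i → F i (i + (N ∸ i))) N ⊹ F N N)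
      ≡⟨ sym (ℚ.+-assoc (cols N) _ (F N N)) ⟩
    (cols N ⊹ sumTo (λ i → F i (i + (N ∸ i))) N) ⊹ F N N
      ≡⟨ cong₂ _⊹_ (sym (sumTo-+ _ _ N)) (sym (trans (ℚ.+-identityˡ _) (cong (F N) (+-comm N 0)))) ⟩
    sumTo (λ i → sumTo (λ j → F i (i + j)) (suc (N ∸ i))) N ⊹ sumTo (λ j → F N (N + j)) 1
      ≡⟨ cong₂ _⊹_ (sumTo-cong N (λ i i<N → cong (sumTo (λ j → F i (i + j)))
                                                  (sym (+-∸-assoc 1 (≤-trans (n≤1+n i) i<N)))))
                   (cong (sumTo (λ j → F N (N + j))) (sym (m+n∸n≡m 1 N))) ⟩
    cols (suc N) ∎
  where
  open ≡-Reasoning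
  rows cols : ℕ → ℚ
  rows N = sumTo (λ m → sumTo (λ i → F i m) (suc m)) N
  cols M = sumTo (λ i → sumTo (λ j → F i (i + j)) (M ∸ i)) M

module ≗-Reasoning = SetoidReasoning (ℕ →-setoid ℚ)
open Setoid (ℕ →-setoid ℚ) using () renaming (sym to ≗-sym; trans to ≗-trans)

⊛-cong : ∀ {f f′ g g′ : Series} → f ≗ f′ → g ≗ g′ → f ⊛ g ≗ f′ ⊛ g′
⊛-cong ef eg n = sumTo-cong (suc n) (λ i _ → cong₂ _·_ (ef i) (eg (n ∸ i)))

⊛-congˡ : ∀ {f f′} g → f ≗ f′ → f ⊛ g ≗ f′ ⊛ g
⊛-congˡ g ef = ⊛-cong {g = g} ef (λ _ → refl)

⊛-congʳ : ∀ f {g g′} → g ≗ g′ → f ⊛ g ≗ f ⊛ g′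
⊛-congʳ f eg = ⊛-cong {f = f} (λ _ → refl) eg

⊛-comm : ∀ f g → f ⊛ g ≗ g ⊛ f
⊛-comm f g n = trans (sumTo-reverse (λ i → f i · g (n ∸ i)) n)
  (sumTo-cong (suc n) (λ i i<1+n →
    trans (cong (λ x → f (n ∸ i) · g x) (m∸[m∸n]≡n (≤-pred i<1+n))) (ℚ.*-comm (f (n ∸ i)) (g i))))

⊛-assoc : ∀ f g h → (f ⊛ g) ⊛ h ≗ f ⊛ (g ⊛ h)
⊛-assoc f g h n = begin
    sumTo (λ m → sumTo (λ i → f i · g (m ∸ i)) (suc m) · h (n ∸ m)) (suc n)
      ≡⟨ sumTo-cong (suc n) (λ m _ → sym (sumTo-scaleʳ (h (n ∸ m)) (λ i → f i · g (m ∸ i)) (suc m))) ⟩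
    sumTo (λ m → sumTo (λ i → f i · g (m ∸ i) · h (n ∸ m)) (suc m)) (suc n)
      ≡⟨ sumTo-triangle (λ i m → f i · g (m ∸ i) · h (n ∸ m)) (suc n) ⟩
    sumTo (λ i → sumTo (λ j → f i · g (i + j ∸ i) · h (n ∸ (i + j))) (suc n ∸ i)) (suc n)
      ≡⟨ sumTo-cong (suc n) inner ⟩
    sumTo (λ i → f i · sumTo (λ j → g j · h (n ∸ i ∸ j)) (suc (n ∸ i))) (suc n) ∎
  where
  open ≡-Reasoning
  inner : ∀ i → i < suc n →
    sumTo (λ j → f i · g (i + j ∸ i) · h (n ∸ (i + j))) (suc n ∸ i)
      ≡ f i · sumTo (λ j → g j · h (n ∸ i ∸ j)) (suc (n ∸ i))
  inner i i<1+n = begin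
      sumTo (λ j → f i · g (i + j ∸ i) · h (n ∸ (i + j))) (suc n ∸ i)
        ≡⟨ cong (sumTo _) (+-∸-assoc 1 (≤-pred i<1+n)) ⟩
      sumTo (λ j → f i · g (i + j ∸ i) · h (n ∸ (i + j))) (suc (n ∸ i))
        ≡⟨ sumTo-cong (suc (n ∸ i)) (λ j _ → trans
             (cong₂ (λ x y → f i · g x · h y) (m+n∸m≡n i j) (sym (∸-+-assoc n i j)))
             (ℚ.*-assoc (f i) (g j) (h (n ∸ i ∸ j)))) ⟩
      sumTo (λ j → f i · (g j · h (n ∸ i ∸ j))) (suc (n ∸ i))
        ≡⟨ sumTo-scaleˡ (f i) (λ j → g j · h (n ∸ i ∸ j)) (suc (n ∸ i)) ⟩
      f i · sumTo (λ j → g j · h (n ∸ i ∸ j)) (suc (n ∸ i)) ∎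

⊛-distribˡ : ∀ f g h → f ⊛ (g ⊕ h) ≗ (f ⊛ g) ⊕ (f ⊛ h)
⊛-distribˡ f g h n =
  trans (sumTo-cong (suc n) (λ i _ → ℚ.*-distribˡ-+ (f i) (g (n ∸ i)) (h (n ∸ i))))
        (sumTo-+ (λ i → f i · g (n ∸ i)) (λ i → f i · h (n ∸ i)) (suc n))

⊛-distribʳ : ∀ f g h → (g ⊕ h) ⊛ f ≗ (g ⊛ f) ⊕ (h ⊛ f)
⊛-distribʳ f g h n =
  trans (⊛-comm (g ⊕ h) f n) (trans (⊛-distribˡ f g h n) (cong₂ _⊹_ (⊛-comm f g n) (⊛-comm f h n)))

⊛-scaleˡ : ∀ c f g → scale c f ⊛ g ≗ scale c (f ⊛ g)
⊛-scaleˡ c f g n = trans (sumTo-cong (suc n) (λ i _ → ℚ.*-assoc c (f i) (g (n ∸ i))))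
                         (sumTo-scaleˡ c (λ i → f i · g (n ∸ i)) (suc n))

⊛-zeroˡ : ∀ g → zeroS ⊛ g ≗ zeroS
⊛-zeroˡ g n = sumTo-zero (suc n) (λ i _ → ℚ.*-zeroˡ (g (n ∸ i)))

⊛-identityˡ : ∀ g → oneS ⊛ g ≗ g
⊛-identityˡ g n = trans (sumTo-front (λ i → oneS i · g (n ∸ i)) n)
  (trans (cong₂ _⊹_ (ℚ.*-identityˡ (g n)) (sumTo-zero n (λ i _ → ℚ.*-zeroˡ (g (n ∸ suc i)))))
         (ℚ.+-identityʳ (g n)))

⊛-identityʳ : ∀ g → g ⊛ oneS ≗ g
⊛-identityʳ g n = trans (⊛-comm g oneS n) (⊛-identityˡ g n)

⊛-interchange : ∀ a b c d → (a ⊛ b) ⊛ (c ⊛ d) ≗ (a ⊛ c) ⊛ (b ⊛ d)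
⊛-interchange a b c d = begin
    (a ⊛ b) ⊛ (c ⊛ d)   ≈⟨ ⊛-assoc a b (c ⊛ d) ⟩
    a ⊛ (b ⊛ (c ⊛ d))   ≈⟨ ⊛-congʳ a (≗-sym (⊛-assoc b c d)) ⟩
    a ⊛ ((b ⊛ c) ⊛ d)   ≈⟨ ⊛-congʳ a (⊛-congˡ d (⊛-comm b c)) ⟩
    a ⊛ ((c ⊛ b) ⊛ d)   ≈⟨ ⊛-congʳ a (⊛-assoc c b d) ⟩
    a ⊛ (c ⊛ (b ⊛ d))   ≈⟨ ≗-sym (⊛-assoc a c (b ⊛ d)) ⟩
    (a ⊛ c) ⊛ (b ⊛ d)   ∎
  where open ≗-Reasoning

⊛-leftComm : ∀ a b c → a ⊛ (b ⊛ c) ≗ b ⊛ (a ⊛ c)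
⊛-leftComm a b c = begin
    a ⊛ (b ⊛ c)   ≈⟨ ≗-sym (⊛-assoc a b c) ⟩
    (a ⊛ b) ⊛ c   ≈⟨ ⊛-congˡ c (⊛-comm a b) ⟩
    (b ⊛ a) ⊛ c   ≈⟨ ⊛-assoc b a c ⟩
    b ⊛ (a ⊛ c)   ∎
  where open ≗-Reasoning

⊕-cong : ∀ {f f′ g g′ : Series} → f ≗ f′ → g ≗ g′ → f ⊕ g ≗ f′ ⊕ g′
⊕-cong ef eg n = cong₂ _⊹_ (ef n) (eg n)

⊕-assoc : ∀ f g h → (f ⊕ g) ⊕ h ≗ f ⊕ (g ⊕ h)
⊕-assoc f g h n = ℚ.+-assoc (f n) (g n) (h n)

⊛-expand : ∀ X x Y y → (X ⊕ x) ⊛ (Y ⊕ y) ≗ (X ⊛ Y) ⊕ ((x ⊛ Y) ⊕ ((X ⊛ y) ⊕ (x ⊛ y)))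
⊛-expand X x Y y = begin
    (X ⊕ x) ⊛ (Y ⊕ y)                                   ≈⟨ ⊛-distribˡ (X ⊕ x) Y y ⟩
    ((X ⊕ x) ⊛ Y) ⊕ ((X ⊕ x) ⊛ y)                       ≈⟨ ⊕-cong (⊛-distribʳ Y X x) (⊛-distribʳ y X x) ⟩
    ((X ⊛ Y) ⊕ (x ⊛ Y)) ⊕ ((X ⊛ y) ⊕ (x ⊛ y))           ≈⟨ ⊕-assoc (X ⊛ Y) (x ⊛ Y) _ ⟩
    (X ⊛ Y) ⊕ ((x ⊛ Y) ⊕ ((X ⊛ y) ⊕ (x ⊛ y)))           ∎
  where open ≗-Reasoning

-- A list L of pairs (c , x) stands for the
-- formal sum Σ c·x; given an interpretation F of the objects x as series,
-- lin F L is the series it denotes.  This is the shape in which both the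
-- hypothesis of the theorem and membership in Z(Q,S) are phrased.

lin : {X : Set} → (X → Series) → List (ℚ × X) → Series
lin F L = linComb (map (λ p → (proj₁ p , F (proj₂ p))) L)

module _ {X : Set} where

  lin-cong-at : ∀ {F G : X → Series} L {m n} → (∀ x → F x m ≡ G x n) → lin F L m ≡ lin G L n
  lin-cong-at []            e = refl
  lin-cong-at ((c , x) ∷ L) e = cong₂ (λ u v → c · u ⊹ v) (e x) (lin-cong-at L e)

  lin-cong : ∀ {F G : X → Series} L → (∀ x → F x ≗ G x) → lin F L ≗ lin G L
  lin-cong L e n = lin-cong-at L (λ x → e x n)

  lin-congᴬ : ∀ {F G : X → Series} L → All (λ p → F (proj₂ p) ≗ G (proj₂ p)) L → lin F L ≗ lin G L
  lin-congᴬ []            []       n = refl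
  lin-congᴬ ((c , x) ∷ L) (e ∷ es) n = cong₂ (λ u v → c · u ⊹ v) (e n) (lin-congᴬ L es n)

  lin-zero-at : ∀ {F : X → Series} L {n} → (∀ x → F x n ≡ 0ℚ) → lin F L n ≡ 0ℚ
  lin-zero-at []            e = refl
  lin-zero-at ((c , x) ∷ L) e =
    trans (cong₂ (λ u v → c · u ⊹ v) (e x) (lin-zero-at L e))
          (trans (cong (_⊹ 0ℚ) (ℚ.*-zeroʳ c)) (ℚ.+-identityʳ 0ℚ))

  lin-++ : ∀ (F : X → Series) L M → lin F (L ++ M) ≗ lin F L ⊕ lin F M
  lin-++ F []            M n = sym (ℚ.+-identityˡ (lin F M n))
  lin-++ F ((c , x) ∷ L) M n =
    trans (cong (c · F x n ⊹_) (lin-++ F L M n)) (sym (ℚ.+-assoc (c · F x n) (lin F L n) (lin F M n)))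

  lin-⊕ : ∀ (F G : X → Series) L → lin (λ x → F x ⊕ G x) L ≗ lin F L ⊕ lin G L
  lin-⊕ F G []            n = sym (ℚ.+-identityˡ 0ℚ)
  lin-⊕ F G ((c , x) ∷ L) n = trans (cong (c · (F x n ⊹ G x n) ⊹_) (lin-⊕ F G L n))
    (solve 5 (λ c u v l m → c :* (u :+ v) :+ (l :+ m) := (c :* u :+ l) :+ (c :* v :+ m)) refl
       c (F x n) (G x n) (lin F L n) (lin G L n))

  lin-⊛ʳ : ∀ (F : X → Series) g L → lin F L ⊛ g ≗ lin (λ x → F x ⊛ g) L
  lin-⊛ʳ F g []            = ⊛-zeroˡ g
  lin-⊛ʳ F g ((c , x) ∷ L) = begin
      (scale c (F x) ⊕ lin F L) ⊛ g          ≈⟨ ⊛-distribʳ g (scale c (F x)) (lin F L) ⟩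
      (scale c (F x) ⊛ g) ⊕ (lin F L ⊛ g)    ≈⟨ ⊕-cong (⊛-scaleˡ c (F x) g) (lin-⊛ʳ F g L) ⟩
      scale c (F x ⊛ g) ⊕ lin (λ y → F y ⊛ g) L ∎
    where open ≗-Reasoning

  lin-⊛ˡ : ∀ (F : X → Series) f L → f ⊛ lin F L ≗ lin (λ x → f ⊛ F x) L
  lin-⊛ˡ F f L = ≗-trans (⊛-comm f (lin F L))
    (≗-trans (lin-⊛ʳ F f L) (lin-cong L (λ x → ⊛-comm (F x) f)))

  lin-map : ∀ {Y : Set} (F : Y → Series) (g : X → Y) L → lin F (map (map₂ g) L) ≗ lin (F ∘ g) L
  lin-map F g []            n = refl
  lin-map F g ((c , x) ∷ L) n = cong (c · F (g x) n ⊹_) (lin-map F g L n)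

-- Scaling all coefficients of a combination, and substituting a combination
-- for every object of a combination (the free-module monad on ℚ).

scaleLin : {X : Set} → ℚ → List (ℚ × X) → List (ℚ × X)
scaleLin c = map (λ p → (c · proj₁ p , proj₂ p))

bind : {X Y : Set} → List (ℚ × X) → (X → List (ℚ × Y)) → List (ℚ × Y)
bind []            f = []
bind ((c , x) ∷ L) f = scaleLin c (f x) ++ bind L f

module _ {Y : Set} (F : Y → Series) where

  lin-scale : ∀ c L → lin F (scaleLin c L) ≗ scale c (lin F L)
  lin-scale c []            n = sym (ℚ.*-zeroʳ c)
  lin-scale c ((d , y) ∷ L) n = trans (cong ((c · d) · F y n ⊹_) (lin-scale c L n))
    (solve 4 (λ c d u l → (c :* d) :* u :+ c :* l := c :* (d :* u :+ l)) refl c d (F y n) (lin F L n))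

  lin-bind : ∀ {X : Set} (L : List (ℚ × X)) f → lin F (bind L f) ≗ lin (λ x → lin F (f x)) L
  lin-bind []            f n = refl
  lin-bind ((c , x) ∷ L) f n =
    trans (lin-++ F (scaleLin c (f x)) (bind L f) n)
          (cong₂ _⊹_ (lin-scale c (f x) n) (lin-bind L f n))

oneMinusT⊛geom : oneMinusT ⊛ geom ≗ oneS
oneMinusT⊛geom zero    = refl
oneMinusT⊛geom (suc m) =
  trans (sumTo-front (λ i → oneMinusT i · geom (suc m ∸ i)) (suc m))
        (cong (λ x → 1ℚ · 1ℚ ⊹ x)
              (trans (sumTo-front (λ i → oneMinusT (suc i) · geom (m ∸ i)) m)
                     (cong (λ x → - 1ℚ · 1ℚ ⊹ x) (sumTo-zero m (λ i _ → ℚ.*-zeroˡ 1ℚ)))))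

powS-+ : ∀ f a b → powS f (a + b) ≗ powS f a ⊛ powS f b
powS-+ f zero    b = ≗-sym (⊛-identityˡ (powS f b))
powS-+ f (suc a) b = ≗-trans (⊛-congʳ f (powS-+ f a b)) (≗-sym (⊛-assoc f (powS f a) (powS f b)))

geom-cancel : ∀ m → powS oneMinusT m ⊛ powS geom m ≗ oneS
geom-cancel zero    = ⊛-identityˡ oneS
geom-cancel (suc m) = begin
    (oneMinusT ⊛ powS oneMinusT m) ⊛ (geom ⊛ powS geom m)
      ≈⟨ ⊛-interchange oneMinusT (powS oneMinusT m) geom (powS geom m) ⟩
    (oneMinusT ⊛ geom) ⊛ (powS oneMinusT m ⊛ powS geom m)
      ≈⟨ ⊛-cong oneMinusT⊛geom (geom-cancel m) ⟩
    oneS ⊛ oneS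
      ≈⟨ ⊛-identityˡ oneS ⟩
    oneS ∎
  where open ≗-Reasoning

shift-denominator : ∀ P {j N} → j ≤ N → (powS oneMinusT (N ∸ j) ⊛ P) ⊛ powS geom N ≗ P ⊛ powS geom j
shift-denominator P {j} {N} j≤N = begin
    (powS oneMinusT (N ∸ j) ⊛ P) ⊛ powS geom N
      ≈⟨ ⊛-congʳ (powS oneMinusT (N ∸ j) ⊛ P) (λ n → cong (λ e → powS geom e n) (sym (m∸n+n≡m j≤N))) ⟩
    (powS oneMinusT (N ∸ j) ⊛ P) ⊛ powS geom (N ∸ j + j)
      ≈⟨ ⊛-congʳ (powS oneMinusT (N ∸ j) ⊛ P) (powS-+ geom (N ∸ j) j) ⟩
    (powS oneMinusT (N ∸ j) ⊛ P) ⊛ (powS geom (N ∸ j) ⊛ powS geom j)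
      ≈⟨ ⊛-interchange (powS oneMinusT (N ∸ j)) P (powS geom (N ∸ j)) (powS geom j) ⟩
    (powS oneMinusT (N ∸ j) ⊛ powS geom (N ∸ j)) ⊛ (P ⊛ powS geom j)
      ≈⟨ ⊛-congˡ (P ⊛ powS geom j) (geom-cancel (N ∸ j)) ⟩
    oneS ⊛ (P ⊛ powS geom j)
      ≈⟨ ⊛-identityˡ (P ⊛ powS geom j) ⟩
    P ⊛ powS geom j ∎
  where open ≗-Reasoning

fraction-mul : ∀ Pa Pb a b (R : ℕ → Series) ls → All (λ p → proj₂ p ≤ a + b) ls →
  Pa ⊛ Pb ≗ lin (λ j → powS oneMinusT (a + b ∸ j) ⊛ R j) ls →
  (Pa ⊛ powS geom a) ⊛ (Pb ⊛ powS geom b) ≗ lin (λ j → R j ⊛ powS geom j) ls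
fraction-mul Pa Pb a b R ls bounded product = begin
    (Pa ⊛ powS geom a) ⊛ (Pb ⊛ powS geom b)
      ≈⟨ ⊛-interchange Pa (powS geom a) Pb (powS geom b) ⟩
    (Pa ⊛ Pb) ⊛ (powS geom a ⊛ powS geom b)
      ≈⟨ ⊛-cong product (≗-sym (powS-+ geom a b)) ⟩
    lin (λ j → powS oneMinusT (a + b ∸ j) ⊛ R j) ls ⊛ powS geom (a + b)
      ≈⟨ lin-⊛ʳ _ (powS geom (a + b)) ls ⟩
    lin (λ j → (powS oneMinusT (a + b ∸ j) ⊛ R j) ⊛ powS geom (a + b)) ls
      ≈⟨ lin-congᴬ ls (All.map (shift-denominator (R _)) bounded) ⟩
    lin (λ j → R j ⊛ powS geom j) ls ∎
  where open ≗-Reasoning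

-- The substitution t ↦ t^d (d = suc k), Defs.substPow g k, is a ring
-- homomorphism on power series.  Its coefficients are g (m/d) at multiples
-- m of d and 0 elsewhere.

substPow-on : ∀ g k m → suc k ∣ m → substPow g k m ≡ g (m / suc k)
substPow-on g k m d∣m with m % suc k ≟ 0
... | yes _  = refl
... | no m≢0 = ⊥-elim (m≢0 (n∣m⇒m%n≡0 m (suc k) d∣m))

substPow-off : ∀ g k m → ¬ suc k ∣ m → substPow g k m ≡ 0ℚ
substPow-off g k m d∤m with m % suc k ≟ 0
... | yes m≡0 = ⊥-elim (d∤m (m%n≡0⇒n∣m m (suc k) m≡0))
... | no _    = refl

substPow-cong : ∀ {f g} k → f ≗ g → substPow f k ≗ substPow g k
substPow-cong k e m with m % suc k ≟ 0
... | yes _ = e (m / suc k)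
... | no _  = refl

substPow-lin : ∀ {X : Set} (F : X → Series) L k → substPow (lin F L) k ≗ lin (λ x → substPow (F x) k) L
substPow-lin F L k m with suc k ∣? m
... | yes d∣m = trans (substPow-on (lin F L) k m d∣m)
                      (lin-cong-at L (λ x → sym (substPow-on (F x) k m d∣m)))
... | no d∤m  = trans (substPow-off (lin F L) k m d∤m)
                      (sym (lin-zero-at L (λ x → substPow-off (F x) k m d∤m)))

sumTo-multiples : ∀ (h : ℕ → ℚ) k → (∀ i → ¬ suc k ∣ i → h i ≡ 0ℚ) → ∀ p →
  sumTo h (suc (p * suc k)) ≡ sumTo (λ i → h (i * suc k)) (suc p)
sumTo-multiples h k vanish zero    = refl
sumTo-multiples h k vanish (suc p) = begin
    sumTo h (suc (suc k + p * suc k))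
      ≡⟨ cong (sumTo h ∘ suc) (+-comm (suc k) (p * suc k)) ⟩
    sumTo h (suc (p * suc k) + suc k)
      ≡⟨ sumTo-split h (suc (p * suc k)) (suc k) ⟩
    sumTo h (suc (p * suc k)) ⊹ (sumTo (λ j → h (suc (p * suc k + j))) k ⊹ h (suc (p * suc k + k)))
      ≡⟨ cong₂ (λ x y → x ⊹ (y ⊹ h (suc (p * suc k + k))))
               (sumTo-multiples h k vanish p)
               (sumTo-zero k (λ j j<k → vanish _ (strictly-between j j<k))) ⟩
    sumTo (λ i → h (i * suc k)) (suc p) ⊹ (0ℚ ⊹ h (suc (p * suc k + k)))
      ≡⟨ cong (sumTo (λ i → h (i * suc k)) (suc p) ⊹_)
              (trans (ℚ.+-identityˡ _) (cong (h ∘ suc) (+-comm (p * suc k) k))) ⟩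
    sumTo (λ i → h (i * suc k)) (suc (suc p)) ∎
  where
  open ≡-Reasoning
  strictly-between : ∀ j → j < k → ¬ suc k ∣ suc (p * suc k + j)
  strictly-between j j<k d∣ = <-irrefl refl (≤-trans (∣⇒≤ d∣1+j) j<k)
    where
    d∣1+j : suc k ∣ suc j
    d∣1+j = ∣m+n∣m⇒∣n (subst (suc k ∣_) (sym (+-suc (p * suc k) j)) d∣) (n∣m*n p)

-- Off the multiples of d, the coefficients of f(t^d) g(t^d) vanish: in each
-- product f_i g_(m-i), one of i, m - i is not a multiple of d.
⊛-off-multiples : ∀ f g k m → ¬ suc k ∣ m → (substPow f k ⊛ substPow g k) m ≡ 0ℚ
⊛-off-multiples f g k m d∤m = sumTo-zero (suc m) summand-zero
  where
  summand-zero : ∀ i → i < suc m → substPow f k i · substPow g k (m ∸ i) ≡ 0ℚ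
  summand-zero i i<1+m with suc k ∣? i
  ... | no d∤i  = trans (cong (_· substPow g k (m ∸ i)) (substPow-off f k i d∤i))
                        (ℚ.*-zeroˡ (substPow g k (m ∸ i)))
  ... | yes d∣i = trans (cong (substPow f k i ·_) (substPow-off g k (m ∸ i) d∤m∸i))
                        (ℚ.*-zeroʳ (substPow f k i))
    where
    d∤m∸i : ¬ suc k ∣ m ∸ i
    d∤m∸i d∣m∸i = d∤m (∣m∸n∣n⇒∣m (suc k) (≤-pred i<1+m) d∣m∸i d∣i)

⊛-on-multiples : ∀ f g k p → (substPow f k ⊛ substPow g k) (p * suc k) ≡ (f ⊛ g) p
⊛-on-multiples f g k p =
  trans (sumTo-multiples _ k vanish p) (sumTo-cong (suc p) (λ i _ → cong₂ _·_ (f-at i) (g-at i)))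
  where
  vanish : ∀ i → ¬ suc k ∣ i → substPow f k i · substPow g k (p * suc k ∸ i) ≡ 0ℚ
  vanish i d∤i = trans (cong (_· substPow g k (p * suc k ∸ i)) (substPow-off f k i d∤i))
                       (ℚ.*-zeroˡ (substPow g k (p * suc k ∸ i)))
  f-at : ∀ i → substPow f k (i * suc k) ≡ f i
  f-at i = trans (substPow-on f k (i * suc k) (n∣m*n i)) (cong f (m*n/n≡m i (suc k)))
  g-at : ∀ i → substPow g k (p * suc k ∸ i * suc k) ≡ g (p ∸ i)
  g-at i = trans (cong (substPow g k) (sym (*-distribʳ-∸ (suc k) p i)))
                 (trans (substPow-on g k _ (n∣m*n (p ∸ i))) (cong g (m*n/n≡m (p ∸ i) (suc k))))

substPow-⊛ : ∀ f g k → substPow (f ⊛ g) k ≗ substPow f k ⊛ substPow g k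
substPow-⊛ f g k m with suc k ∣? m
... | no d∤m  = trans (substPow-off (f ⊛ g) k m d∤m) (sym (⊛-off-multiples f g k m d∤m))
... | yes d∣m = begin
    substPow (f ⊛ g) k m                                  ≡⟨ substPow-on (f ⊛ g) k m d∣m ⟩
    (f ⊛ g) (m / suc k)                                   ≡⟨ sym (⊛-on-multiples f g k (m / suc k)) ⟩
    (substPow f k ⊛ substPow g k) (m / suc k * suc k)     ≡⟨ cong (substPow f k ⊛ substPow g k) (m/n*n≡m d∣m) ⟩
    (substPow f k ⊛ substPow g k) m                       ∎
  where open ≡-Reasoning

-- For a family t a k of series indexed by letters a and by
-- k ∈ ℕ, and a word w = a₁ ⋯ a_l,
--   iterSum t w B = Σ_{B > k₁ > ⋯ > k_l ≥ 0} t a₁ k₁ ⋯ t a_l k_l.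
-- The series T Q of Defs is the case t s k = Q_s(q^(k+1)) / (1 - q^(k+1))^s.

iterSum : {A : Set} → (A → ℕ → Series) → List A → ℕ → Series
iterSum t []      B = oneS
iterSum t (a ∷ w) B = sumSer (λ k → t a k ⊛ iterSum t w k) B

module Combinations {A : Set} (t : A → ℕ → Series) where

  Word : Set
  Word = List A

  Lin : Set
  Lin = List (ℚ × Word)

  ev : ℕ → Lin → Series
  ev B = lin (λ w → iterSum t w B)

  prefix : A → Lin → Lin
  prefix a = map (map₂ (a ∷_))

  ev-single : ∀ B w → ev B ((1ℚ , w) ∷ []) ≗ iterSum t w B
  ev-single B w n = trans (ℚ.+-identityʳ _) (ℚ.*-identityˡ _)

  -- Splitting off the summand k₁ = B in iterSum (a w) (B + 1).
  ev-prefix-step : ∀ B a L → ev (suc B) (prefix a L) ≗ ev B (prefix a L) ⊕ (t a B ⊛ ev B L)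
  ev-prefix-step B a L = begin
      ev (suc B) (prefix a L)
        ≈⟨ lin-map (λ w → iterSum t w (suc B)) (a ∷_) L ⟩
      lin (λ w → iterSum t (a ∷ w) B ⊕ (t a B ⊛ iterSum t w B)) L
        ≈⟨ lin-⊕ (λ w → iterSum t (a ∷ w) B) (λ w → t a B ⊛ iterSum t w B) L ⟩
      lin (λ w → iterSum t (a ∷ w) B) L ⊕ lin (λ w → t a B ⊛ iterSum t w B) L
        ≈⟨ ⊕-cong (≗-sym (lin-map (λ w → iterSum t w B) (a ∷_) L))
                  (≗-sym (lin-⊛ˡ (λ w → iterSum t w B) (t a B) L)) ⟩
      ev B (prefix a L) ⊕ (t a B ⊛ ev B L) ∎
    where open ≗-Reasoning

  ev-prefixes-step : ∀ B ls L → ev (suc B) (bind ls (λ j → prefix j L))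
    ≗ ev B (bind ls (λ j → prefix j L)) ⊕ (lin (λ j → t j B) ls ⊛ ev B L)
  ev-prefixes-step B ls L = begin
      ev (suc B) (bind ls (λ j → prefix j L))
        ≈⟨ lin-bind _ ls (λ j → prefix j L) ⟩
      lin (λ j → ev (suc B) (prefix j L)) ls
        ≈⟨ lin-cong ls (λ j → ev-prefix-step B j L) ⟩
      lin (λ j → ev B (prefix j L) ⊕ (t j B ⊛ ev B L)) ls
        ≈⟨ lin-⊕ _ _ ls ⟩
      lin (λ j → ev B (prefix j L)) ls ⊕ lin (λ j → t j B ⊛ ev B L) ls
        ≈⟨ ⊕-cong (≗-sym (lin-bind _ ls (λ j → prefix j L))) (≗-sym (lin-⊛ʳ (λ j → t j B) (ev B L) ls)) ⟩
      ev B (bind ls (λ j → prefix j L)) ⊕ (lin (λ j → t j B) ls ⊛ ev B L) ∎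
    where open ≗-Reasoning

  ev-step-++ : ∀ B L M {D E} → ev (suc B) L ≗ ev B L ⊕ D → ev (suc B) M ≗ ev B M ⊕ E →
    ev (suc B) (L ++ M) ≗ ev B (L ++ M) ⊕ (D ⊕ E)
  ev-step-++ B L M {D} {E} stepL stepM n =
    trans (lin-++ _ L M n)
      (trans (cong₂ _⊹_ (stepL n) (stepM n))
        (trans (solve 4 (λ l d m e → (l :+ d) :+ (m :+ e) := (l :+ m) :+ (d :+ e)) refl
                  (ev B L n) (D n) (ev B M n) (E n))
               (cong (_⊹ (D n ⊹ E n)) (sym (lin-++ _ L M n)))))

  -- With B = 0, every nonempty word has the empty iterated sum 0.
  ev-prefix-zero : ∀ a L → ev 0 (prefix a L) ≗ zeroS
  ev-prefix-zero a L n = trans (lin-map (λ w → iterSum t w 0) (a ∷_) L n) (lin-zero-at L (λ w → refl))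

  ev-zero-++ : ∀ L M → ev 0 L ≗ zeroS → ev 0 M ≗ zeroS → ev 0 (L ++ M) ≗ zeroS
  ev-zero-++ L M zeroL zeroM n =
    trans (lin-++ _ L M n) (trans (cong₂ _⊹_ (zeroL n) (zeroM n)) (ℚ.+-identityʳ 0ℚ))

module QuasiShuffle {A : Set} (t : A → ℕ → Series) (_⋄_ : A → A → List (ℚ × A))
  (t-mul : ∀ a b k → t a k ⊛ t b k ≗ lin (λ j → t j k) (a ⋄ b)) where

  open Combinations t public

  _∗_ : Word → Word → Lin
  []      ∗ v       = (1ℚ , v) ∷ []
  (a ∷ u) ∗ []      = (1ℚ , a ∷ u) ∷ []
  (a ∷ u) ∗ (b ∷ v) = prefix a (u ∗ (b ∷ v))
                   ++ (prefix b ((a ∷ u) ∗ v)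
                   ++ bind (a ⋄ b) (λ j → prefix j (u ∗ v)))

  _⊙_ : Lin → Lin → Lin
  L ⊙ M = bind L (λ u → bind M (λ v → u ∗ v))

  ev-∗-step : ∀ B a u b v → ev (suc B) ((a ∷ u) ∗ (b ∷ v)) ≗ ev B ((a ∷ u) ∗ (b ∷ v))
    ⊕ ((t a B ⊛ ev B (u ∗ (b ∷ v)))
    ⊕ ((t b B ⊛ ev B ((a ∷ u) ∗ v))
    ⊕ (lin (λ j → t j B) (a ⋄ b) ⊛ ev B (u ∗ v))))
  ev-∗-step B a u b v =
    ev-step-++ B (prefix a (u ∗ (b ∷ v))) _ (ev-prefix-step B a (u ∗ (b ∷ v)))
      (ev-step-++ B (prefix b ((a ∷ u) ∗ v)) _ (ev-prefix-step B b ((a ∷ u) ∗ v))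
        (ev-prefixes-step B (a ⋄ b) (u ∗ v)))

  -- For B = 0 all words of (a u) ∗ (b v) are nonempty, so evaluate to 0.
  ev-∗-zero : ∀ a u b v → ev 0 ((a ∷ u) ∗ (b ∷ v)) ≗ zeroS
  ev-∗-zero a u b v =
    ev-zero-++ (prefix a (u ∗ (b ∷ v))) _ (ev-prefix-zero a (u ∗ (b ∷ v)))
      (ev-zero-++ (prefix b ((a ∷ u) ∗ v)) _ (ev-prefix-zero b ((a ∷ u) ∗ v))
        (λ n → trans (lin-bind _ (a ⋄ b) (λ j → prefix j (u ∗ v)) n)
                     (lin-zero-at (a ⋄ b) (λ j → ev-prefix-zero j (u ∗ v) n))))

  iterSum-mul : ∀ B u v → iterSum t u B ⊛ iterSum t v B ≗ ev B (u ∗ v)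
  iterSum-mul B       []      v       = ≗-trans (⊛-identityˡ (iterSum t v B)) (≗-sym (ev-single B v))
  iterSum-mul B       (a ∷ u) []      = ≗-trans (⊛-identityʳ (iterSum t (a ∷ u) B)) (≗-sym (ev-single B (a ∷ u)))
  iterSum-mul zero    (a ∷ u) (b ∷ v) = ≗-trans (⊛-zeroˡ (iterSum t (b ∷ v) 0)) (≗-sym (ev-∗-zero a u b v))
  iterSum-mul (suc B) (a ∷ u) (b ∷ v) = begin
      (X ⊕ (t a B ⊛ U)) ⊛ (Y ⊕ (t b B ⊛ V))
        ≈⟨ ⊛-expand X (t a B ⊛ U) Y (t b B ⊛ V) ⟩
      (X ⊛ Y) ⊕ (((t a B ⊛ U) ⊛ Y) ⊕ ((X ⊛ (t b B ⊛ V)) ⊕ ((t a B ⊛ U) ⊛ (t b B ⊛ V))))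
        ≈⟨ ⊕-cong (iterSum-mul B (a ∷ u) (b ∷ v)) (⊕-cong first (⊕-cong second both)) ⟩
      ev B ((a ∷ u) ∗ (b ∷ v)) ⊕ ((t a B ⊛ ev B (u ∗ (b ∷ v))) ⊕ ((t b B ⊛ ev B ((a ∷ u) ∗ v))
        ⊕ (lin (λ j → t j B) (a ⋄ b) ⊛ ev B (u ∗ v))))
        ≈⟨ ≗-sym (ev-∗-step B a u b v) ⟩
      ev (suc B) ((a ∷ u) ∗ (b ∷ v)) ∎
    where
    open ≗-Reasoning
    X = iterSum t (a ∷ u) B
    Y = iterSum t (b ∷ v) B
    U = iterSum t u B
    V = iterSum t v B
    -- only a takes the largest index B
    first : (t a B ⊛ U) ⊛ Y ≗ t a B ⊛ ev B (u ∗ (b ∷ v))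
    first = ≗-trans (⊛-assoc (t a B) U Y) (⊛-congʳ (t a B) (iterSum-mul B u (b ∷ v)))
    -- only b takes the largest index B
    second : X ⊛ (t b B ⊛ V) ≗ t b B ⊛ ev B ((a ∷ u) ∗ v)
    second = ≗-trans (⊛-leftComm X (t b B) V) (⊛-congʳ (t b B) (iterSum-mul B (a ∷ u) v))
    -- both a and b take the largest index B
    both : (t a B ⊛ U) ⊛ (t b B ⊛ V) ≗ lin (λ j → t j B) (a ⋄ b) ⊛ ev B (u ∗ v)
    both = ≗-trans (⊛-interchange (t a B) U (t b B) V) (⊛-cong (t-mul a b B) (iterSum-mul B u v))

  ev-⊙ : ∀ B L M → ev B (L ⊙ M) ≗ ev B L ⊛ ev B M
  ev-⊙ B L M = begin
      ev B (L ⊙ M)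
        ≈⟨ lin-bind _ L (λ u → bind M (λ v → u ∗ v)) ⟩
      lin (λ u → ev B (bind M (λ v → u ∗ v))) L
        ≈⟨ lin-cong L (λ u → lin-bind _ M (λ v → u ∗ v)) ⟩
      lin (λ u → lin (λ v → ev B (u ∗ v)) M) L
        ≈⟨ lin-cong L (λ u → lin-cong M (λ v → ≗-sym (iterSum-mul B u v))) ⟩
      lin (λ u → lin (λ v → iterSum t u B ⊛ iterSum t v B) M) L
        ≈⟨ lin-cong L (λ u → ≗-sym (lin-⊛ˡ (λ v → iterSum t v B) (iterSum t u B) M)) ⟩
      lin (λ u → iterSum t u B ⊛ ev B M) L
        ≈⟨ ≗-sym (lin-⊛ʳ (λ u → iterSum t u B) (ev B M) L) ⟩
      ev B L ⊛ ev B M ∎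
    where open ≗-Reasoning

module _ {A : Set} (t : A → ℕ → Series) (t-low : ∀ a k n → n ≤ k → t a k n ≡ 0ℚ) where

  ⊛-low : ∀ a k g n → n ≤ k → (t a k ⊛ g) n ≡ 0ℚ
  ⊛-low a k g n n≤k = sumTo-zero (suc n) (λ i i<1+n →
    trans (cong (_· g (n ∸ i)) (t-low a k i (≤-trans (≤-pred i<1+n) n≤k))) (ℚ.*-zeroˡ (g (n ∸ i))))

  iterSum-trunc : ∀ w B n → suc n ≤ B → iterSum t w B n ≡ iterSum t w (suc n) n
  iterSum-trunc []      B n _   = refl
  iterSum-trunc (a ∷ w) B n n<B = begin
      sumTo F B
        ≡⟨ cong (sumTo F) (sym (m+[n∸m]≡n n<B)) ⟩
      sumTo F (suc n + (B ∸ suc n))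
        ≡⟨ sumTo-split F (suc n) (B ∸ suc n) ⟩
      sumTo F (suc n) ⊹ sumTo (λ i → F (suc n + i)) (B ∸ suc n)
        ≡⟨ cong (sumTo F (suc n) ⊹_) (sumTo-zero (B ∸ suc n) (λ i _ →
             ⊛-low a (suc n + i) (iterSum t w (suc n + i)) n (≤-trans (n≤1+n n) (m≤m+n (suc n) i)))) ⟩
      sumTo F (suc n) ⊹ 0ℚ
        ≡⟨ ℚ.+-identityʳ _ ⟩
      sumTo F (suc n) ∎
    where
    open ≡-Reasoning
    F : ℕ → ℚ
    F k = (t a k ⊛ iterSum t w k) n

  ev-trunc : ∀ L B n → suc n ≤ B → Combinations.ev t B L n ≡ Combinations.ev t (suc n) L n
  ev-trunc L B n n<B = lin-cong-at L (λ w → iterSum-trunc w B n n<B)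

substPow-low : ∀ g k n → g 0 ≡ 0ℚ → n ≤ k → substPow g k n ≡ 0ℚ
substPow-low g k n g₀≡0 n≤k with suc k ∣? n
... | yes d∣n = trans (substPow-on g k n d∣n) (trans (cong g (m<n⇒m/n≡0 (s≤s n≤k))) g₀≡0)
... | no d∤n  = substPow-off g k n d∤n

-- Letters are the elements of S (paired with
-- the proof of membership), and the letter s at index k is the series
-- Q_s(q^(k+1)) / (1 - q^(k+1))^s, so that T Q is iterSum of these.

module Letters (S : ℕ → Set) (Q : ℕ → Poly) where

  Letter : Set
  Letter = Σ ℕ S

  termL : Letter → ℕ → Series
  termL a = term Q (proj₁ a)

  T-iterSum : ∀ w B → T Q (map proj₁ w) B ≗ iterSum termL w B
  T-iterSum []      B n = refl
  T-iterSum (a ∷ w) B n = sumTo-cong B (λ k _ → ⊛-congʳ (termL a k) (T-iterSum w k) n)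

  toWord : ∀ {w} → All S w → List Letter
  toWord = All.toList

  toWord-letters : ∀ {w} (w∈S : All S w) → map proj₁ (toWord w∈S) ≡ w
  toWord-letters []         = refl
  toWord-letters (s ∷ w∈S) = cong (_ ∷_) (toWord-letters w∈S)

  attach : ∀ ls → All (λ p → S (proj₂ p)) ls → List (ℚ × Letter)
  attach []             []          = []
  attach ((c , j) ∷ ls) (j∈S ∷ ls∈S) = (c , (j , j∈S)) ∷ attach ls ls∈S

  lin-attach : ∀ (F : ℕ → Series) ls ls∈S → lin (F ∘ proj₁) (attach ls ls∈S) ≗ lin F ls
  lin-attach F []             []           n = refl
  lin-attach F ((c , j) ∷ ls) (_ ∷ ls∈S) n = cong (c · F j n ⊹_) (lin-attach F ls ls∈S n)

  termL-low : (∀ s → S s → coeff (Q s) 0 ≡ 0ℚ) → ∀ a k n → n ≤ k → termL a k n ≡ 0ℚ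
  termL-low hQ0 (s , s∈S) k n =
    substPow-low (poly (Q s) ⊛ powS geom s) k n
      (trans (ℚ.+-identityˡ _) (trans (cong (_· powS geom s 0) (hQ0 s s∈S)) (ℚ.*-zeroˡ (powS geom s 0))))

  open Combinations termL using (Lin; ev)

  InZ-resp : ∀ {f g} → f ≗ g → InZ Q S g → InZ Q S f
  InZ-resp f≗g (cs , cs∈S , g≗) = cs , cs∈S , λ n → trans (f≗g n) (g≗ n)

  realize : ∀ L → InZ Q S (λ N → ev (suc N) L N)
  realize L = map (map₂ (map proj₁)) L , words∈S L , linComb-ev L
    where
    words∈S : ∀ L → All (λ p → All S (proj₂ p)) (map (map₂ (map proj₁)) L)
    words∈S []            = []
    words∈S ((c , w) ∷ L) = All.fromList w ∷ words∈S L
    linComb-ev : ∀ L N → ev (suc N) L N ≡ linComb (mapZ Q (map (map₂ (map proj₁)) L)) N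
    linComb-ev []            N = refl
    linComb-ev ((c , w) ∷ L) N =
      cong₂ (λ x y → c · x ⊹ y) (sym (T-iterSum w (suc N) N)) (linComb-ev L N)

  represent : (∀ s → S s → coeff (Q s) 0 ≡ 0ℚ) → ∀ {f} → InZ Q S f →
    Σ Lin (λ L → ∀ B n → suc n ≤ B → f n ≡ ev B L n)
  represent hQ0 (cs , cs∈S , f≗) = L , λ B n n<B →
    trans (f≗ n) (trans (linComb-ev cs cs∈S n) (sym (ev-trunc termL (termL-low hQ0) L B n n<B)))
    where
    toLin : ∀ cs → All (λ p → All S (proj₂ p)) cs → Lin
    toLin []             []           = []
    toLin ((c , w) ∷ cs) (w∈S ∷ cs∈S) = (c , toWord w∈S) ∷ toLin cs cs∈S
    L = toLin cs cs∈S
    linComb-ev : ∀ cs cs∈S N → linComb (mapZ Q cs) N ≡ ev (suc N) (toLin cs cs∈S) N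
    linComb-ev []             []           N = refl
    linComb-ev ((c , w) ∷ cs) (w∈S ∷ cs∈S) N = cong₂ (λ x y → c · x ⊹ y)
      (trans (cong (λ v → T Q v (suc N) N) (sym (toWord-letters w∈S))) (T-iterSum (toWord w∈S) (suc N) N))
      (linComb-ev cs cs∈S N)

  ProductRule : Set
  ProductRule = ∀ r s → S r → S s →
    ∃ λ (ls : List (ℚ × ℕ)) →
      All (λ p → S (proj₂ p) × (1 ≤ proj₂ p) × (proj₂ p ≤ r + s)) ls ×
      (poly (Q r) ⊛ poly (Q s) ≗ lin (λ j → powS oneMinusT (r + s ∸ j) ⊛ poly (Q j)) ls)

  module LetterProducts (hyp : ProductRule) where

    _⋄_ : Letter → Letter → List (ℚ × Letter)
    (r , r∈S) ⋄ (s , s∈S) = attach (proj₁ H) (All.map proj₁ (proj₁ (proj₂ H)))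
      where H = hyp r s r∈S s∈S

    termL-mul : ∀ a b k → termL a k ⊛ termL b k ≗ lin (λ j → termL j k) (a ⋄ b)
    termL-mul (r , r∈S) (s , s∈S) k = begin
        substPow (poly (Q r) ⊛ powS geom r) k ⊛ substPow (poly (Q s) ⊛ powS geom s) k
          ≈⟨ ≗-sym (substPow-⊛ (poly (Q r) ⊛ powS geom r) (poly (Q s) ⊛ powS geom s) k) ⟩
        substPow ((poly (Q r) ⊛ powS geom r) ⊛ (poly (Q s) ⊛ powS geom s)) k
          ≈⟨ substPow-cong k (fraction-mul (poly (Q r)) (poly (Q s)) r s (poly ∘ Q) ls bounded expansion) ⟩
        substPow (lin (λ j → poly (Q j) ⊛ powS geom j) ls) k
          ≈⟨ substPow-lin (λ j → poly (Q j) ⊛ powS geom j) ls k ⟩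
        lin (λ j → term Q j k) ls
          ≈⟨ ≗-sym (lin-attach (λ j → term Q j k) ls (All.map proj₁ (proj₁ (proj₂ H)))) ⟩
        lin (λ j → termL j k) ((r , r∈S) ⋄ (s , s∈S)) ∎
      where
      open ≗-Reasoning
      H = hyp r s r∈S s∈S
      ls = proj₁ H
      bounded = All.map (proj₂ ∘ proj₂) (proj₁ (proj₂ H))
      expansion = proj₂ (proj₂ H)

-- Write f, g ∈ Z(Q,S)
-- as combinations L, M of words; the q^N coefficient of f g only involves
-- coefficients of f and g of degree ≤ N, which agree with those of ev (N+1) L
-- and ev (N+1) M, so it is that of ev (N+1) L · ev (N+1) M = ev (N+1) (L ⊙ M).
mainTheorem1 : (S : ℕ → Set) (Q : ℕ → Poly) →
    (∀ s → S s → coeff (Q s) 0 ≡ 0ℚ) →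
    (∀ s → S s → ¬ (evalAt1 (Q s) ≡ 0ℚ)) →
    (∀ r s → S r → S s →
      ∃ λ (ls : List (ℚ × ℕ)) →
        All (λ p → S (proj₂ p) × (1 ≤ proj₂ p) × (proj₂ p ≤ r + s)) ls ×
        (∀ n → (poly (Q r) ⊛ poly (Q s)) n ≡
          linComb (map (λ p → (proj₁ p , powS oneMinusT (r + s ∸ proj₂ p) ⊛ poly (Q (proj₂ p)))) ls) n)) →
    ∀ f g → InZ Q S f → InZ Q S g → InZ Q S (f ⊛ g)
mainTheorem1 S Q hQ0 _ hyp f g f∈Z g∈Z = InZ-resp product-coefficients (realize (L ⊙ M))
  where
  open Letters S Q using (termL; InZ-resp; realize; represent; module LetterProducts)
  open LetterProducts hyp using (_⋄_; termL-mul)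
  open QuasiShuffle termL _⋄_ termL-mul using (ev; _⊙_; ev-⊙)
  open ≡-Reasoning
  L = proj₁ (represent hQ0 f∈Z)
  M = proj₁ (represent hQ0 g∈Z)
  product-coefficients : ∀ N → (f ⊛ g) N ≡ ev (suc N) (L ⊙ M) N
  product-coefficients N = begin
      (f ⊛ g) N
        ≡⟨ sumTo-cong (suc N) (λ i i≤N → cong₂ _·_ (proj₂ (represent hQ0 f∈Z) (suc N) i i≤N)
                                                   (proj₂ (represent hQ0 g∈Z) (suc N) (N ∸ i) (s≤s (m∸n≤m N i)))) ⟩
      (ev (suc N) L ⊛ ev (suc N) M) N
        ≡⟨ sym (ev-⊙ (suc N) L M N) ⟩
      ev (suc N) (L ⊙ M) N ∎
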